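{- Define integers $\gamma(k,i)$ for $k\ge 0$ and $i\in\mathbb{Z}$ by $\gamma(0,0)=1$, $\gamma(0,i)=0$ for $i\neq 0$, and, for $k\ge 0$, $$\gamma(k+1,i)=\binom{i-k-1}{2}\gamma(k,i-1)+(i-1)(i-k-2)\gamma(k,i-2)+\binom{i-1}{2}\gamma(k,i-3).$$ Then: (1) for every integer $k\ge 1$ and every integer $n\geq 1$, $$\mathrm{LS}(n+k,n)=2^k\sum_{i=k+2}^{3k}\gamma(k,i)\binom{n+k+1}{i},$$ and the coefficients $\gamma(k,i)$ are positive integers for $k+2\le i\le 3k$; (2) the polynomials $\gamma_k(x)=\sum_{i}\gamma(k,i)x^i$ satisfy, for $k\ge 0$, $$\gamma_{k+1}(x)=\left(\frac{k(k+1)}{2}-kx+x^2\right)x\gamma_k(x)-\left(k+(k-2)x-2x^2\right)x^2\gamma_k'(x)+\frac{(1+x)^2x^3}{2}\gamma_k''(x),$$ with $\gamma_0(x)=1$, $\gamma_1(x)=x^3$ and $\gamma_2(x)=x^4+8x^5+10x^6$.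
   Context: The Legendre-Stirling numbers of the second kind $\mathrm{LS}(n,k)$ ($n,k\ge 0$) are defined by the recurrence $\mathrm{LS}(n,k)=\mathrm{LS}(n-1,k-1)+k(k+1)\mathrm{LS}(n-1,k)$ with initial conditions $\mathrm{LS}(n,0)=\delta_{n,0}$ and $\mathrm{LS}(0,k)=\delta_{0,k}$. For an integer $m\ge 0$, $\binom{y}{m}=\frac{y(y-1)\cdots(y-m+1)}{m!}$ (so $\binom{y}{2}=y(y-1)/2$ for every integer $y$). -}

module Defs where

open import Data.Nat as ℕ using (ℕ; zero; suc; _∸_)
open import Data.Integer as ℤ using (ℤ; +_; _+_; _-_; _*_; -_)
open import Data.Integer.DivMod using (_/_)
open import Relation.Binary.PropositionalEquality using (_≡_)
open import Data.List using (List; []; _∷_; map; upTo; foldr)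
open import Data.Bool using (if_then_else_)
open import Relation.Nullary using (does)

LS : ℕ → ℕ → ℕ
LS zero    zero    = 1
LS zero    (suc k) = 0
LS (suc n) zero    = 0
LS (suc n) (suc k) = LS n k ℕ.+ (suc k ℕ.* suc (suc k)) ℕ.* LS n (suc k)

-- binomial (y choose 2) = y(y-1)/2 for integer y (y(y-1) is always even)
choose2 : ℤ → ℤ
choose2 y = (y * (y - + 1)) / + 2

γ : ℕ → ℤ → ℤ
γ zero    i = if does (i ℤ.≟ + 0) then + 1 else + 0
γ (suc k) i =
    choose2 (i - + k - + 1) * γ k (i - + 1)
  + (i - + 1) * (i - + k - + 2) * γ k (i - + 2)
  + choose2 (i - + 1) * γ k (i - + 3)

sumFT : ℕ → ℕ → (ℕ → ℤ) → ℤ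
sumFT a b f = foldr _+_ (+ 0) (map (λ j → f (a ℕ.+ j)) (upTo (suc b ∸ a)))

-- Formal (Laurent) series with integer coefficients, given by their
-- coefficient function: f i = coefficient of x^i.
Ser : Set
Ser = ℤ → ℤ

_≈S_ : Ser → Ser → Set
f ≈S g = ∀ i → f i ≡ g i
infix 4 _≈S_

_⊕_ : Ser → Ser → Ser
(f ⊕ g) i = f i + g i

_⊖_ : Ser → Ser → Ser
(f ⊖ g) i = f i - g i

infixl 6 _⊕_ _⊖_

scale : ℤ → Ser → Ser
scale c f i = c * f i

mulX : Ser → Ser
mulX f i = f (i - + 1)

-- multiplication by the polynomial c₀ + c₁ x + c₂ x² + … given by its coefficient list
mulP : List ℤ → Ser → Ser
mulP []       f i = + 0
mulP (c ∷ cs) f i = (scale c f ⊕ mulX (mulP cs f)) i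

D : Ser → Ser
D f i = (i + + 1) * f (i + + 1)

mono : ℤ → ℤ → Ser
mono c m i = if does (i ℤ.≟ m) then c else + 0

γpoly : ℕ → Ser
γpoly k i = γ k i

module Submission where

-- The coefficients γ(k,i) are supported on k + 2 ≤ i ≤ 3k and positive there: at such i all three
-- coefficients of the recurrence are positive, and one of the indices i-1, i-2, i-3 lies in the
-- support of γ(k-1,·).
--
-- For the Legendre-Stirling formula put G(k,N) = Σᵢ γ(k,i) C(N,i). Pascal's rule and the absorption
-- identity i C(N,i) = (N-i+1) C(N,i-1) turn the recurrence of γ into
--   2 G(k+1,N+1) = 2 G(k+1,N) + (N-k)(N-k-1) G(k,N),
-- which for N = n+k+1 is the recurrence LS(n+k+1,n+1) = LS(n+k,n) + (n+1)(n+2) LS(n+k,n+1) scaled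
-- by 2^(k+1). The differential equation is the recurrence of γ read off coefficientwise.

open import Defs
open import Algebra.Properties.CommutativeSemigroup using (interchange)
open import Data.Integer using (ℤ; +_; -[1+_]; _+_; _-_; _*_; -_; _<_; +<+)
open import Data.Integer.DivMod using (_/_; div-pos-is-/ℕ)
open import Data.Integer.Properties
  using (pos-*; pos-+; *-zeroʳ; +-identityˡ; +-identityʳ; +-assoc; +-comm; *-assoc; *-distribˡ-+;
         [1+m]⊖[1+n]≡m⊖n; +-commutativeSemigroup)
open import Data.Integer.Tactic.RingSolver using (solve; solve-∀)
open import Data.List using (List; _∷_; []; foldr; applyUpTo)
open import Data.List.Properties using (map-upTo)
open import Data.Nat as ℕ using (ℕ; zero; suc; z≤n; s≤s)
open import Data.Nat using (_≤_; _^_)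
open import Data.Nat.Combinatorics using (_C_; nCk+nC[k+1]≡[n+1]C[k+1]; k>n⇒nCk≡0)
open import Data.Nat.DivMod using (m*n/n≡m)
import Data.Nat.Properties as ℕP
import Data.Nat.Tactic.RingSolver as ℕ-Solver
open import Data.Product using (∃-syntax; _,_; _×_)
open import Data.Sum using (_⊎_; inj₁; inj₂)
open import Function using (_∘_)
open import Relation.Binary.PropositionalEquality
open import Relation.Nullary using (yes; no)
open ≡-Reasoning

NonNeg Pos : ℤ → Set
NonNeg i = ∃[ n ] i ≡ + n
Pos i = ∃[ n ] i ≡ + suc n

Pos⇒NonNeg : ∀ {i} → Pos i → NonNeg i
Pos⇒NonNeg (n , i≡) = suc n , i≡

*-NonNeg : ∀ {i j} → NonNeg i → NonNeg j → NonNeg (i * j)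
*-NonNeg (m , refl) (n , refl) = m ℕ.* n , sym (pos-* m n)

*-Pos : ∀ {i j} → Pos i → Pos j → Pos (i * j)
*-Pos (m , refl) (n , refl) = n ℕ.+ m ℕ.* suc n , refl

+-Pos-NonNeg : ∀ {i j} → Pos i → NonNeg j → Pos (i + j)
+-Pos-NonNeg (m , refl) (n , refl) = m ℕ.+ n , refl

+-NonNeg : ∀ {i j} → NonNeg i → NonNeg j → NonNeg (i + j)
+-NonNeg (m , refl) (n , refl) = m ℕ.+ n , refl

+-NonNeg-Pos : ∀ {i j} → NonNeg i → Pos j → Pos (i + j)
+-NonNeg-Pos (m , refl) (n , refl) = m ℕ.+ n , cong +_ (ℕP.+-suc m n)

pronic-half : ∀ a → ∃[ t ] a ℕ.* suc a ≡ t ℕ.* 2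
pronic-half zero = 0 , refl
pronic-half (suc a) with t , a[a+1]≡2t ← pronic-half a = t ℕ.+ suc a , (begin
  suc a ℕ.* suc (suc a)    ≡⟨ ℕ-Solver.solve (a ∷ []) ⟩
  a ℕ.* suc a ℕ.+ 2 ℕ.* suc a ≡⟨ cong (ℕ._+ 2 ℕ.* suc a) a[a+1]≡2t ⟩
  t ℕ.* 2 ℕ.+ 2 ℕ.* suc a   ≡⟨ ℕ-Solver.solve (t ∷ a ∷ []) ⟩
  (t ℕ.+ suc a) ℕ.* 2      ∎)

y[y-1]-pronic : ∀ y → ∃[ a ] y * (y - + 1) ≡ + (a ℕ.* suc a)
y[y-1]-pronic (+ zero)  = 0 , refl
y[y-1]-pronic (+ suc m) = m , trans (sym (pos-* (suc m) m)) (cong +_ (ℕP.*-comm (suc m) m))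
y[y-1]-pronic -[1+ n ]  = suc n , cong (λ m → + (suc n ℕ.* suc (suc m))) (ℕP.+-identityʳ n)

choose2-exact-half : ∀ y → ∃[ t ] choose2 y ≡ + t × y * (y - + 1) ≡ + (t ℕ.* 2)
choose2-exact-half y with a , y[y-1]≡ ← y[y-1]-pronic y with t , a[a+1]≡ ← pronic-half a =
  t , (begin
    choose2 y                ≡⟨ cong (_/ + 2) y[y-1]≡2t ⟩
    + (t ℕ.* 2) / + 2        ≡⟨ div-pos-is-/ℕ (+ (t ℕ.* 2)) 2 ⟩
    + ((t ℕ.* 2) ℕ./ 2)      ≡⟨ cong +_ (m*n/n≡m t 2) ⟩
    + t                      ∎) , y[y-1]≡2t
  where
  y[y-1]≡2t : y * (y - + 1) ≡ + (t ℕ.* 2)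
  y[y-1]≡2t = trans y[y-1]≡ (cong +_ a[a+1]≡)

two-choose2 : ∀ y → + 2 * choose2 y ≡ y * (y - + 1)
two-choose2 y with t , choose2≡t , y[y-1]≡2t ← choose2-exact-half y = begin
  + 2 * choose2 y ≡⟨ cong (+ 2 *_) choose2≡t ⟩
  + 2 * + t       ≡⟨ sym (pos-* 2 t) ⟩
  + (2 ℕ.* t)     ≡⟨ cong +_ (ℕP.*-comm 2 t) ⟩
  + (t ℕ.* 2)     ≡⟨ sym y[y-1]≡2t ⟩
  y * (y - + 1)   ∎

choose2-nonneg : ∀ y → NonNeg (choose2 y)
choose2-nonneg y with t , choose2≡t , _ ← choose2-exact-half y = t , choose2≡t

choose2-pos : ∀ n → Pos (choose2 (+ suc (suc n)))
choose2-pos n with choose2-exact-half (+ suc (suc n))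
... | suc t , choose2≡t , _ = t , choose2≡t
... | zero  , _ , ()

γ-suc-vanishes : ∀ k i → γ k (i - + 1) ≡ + 0 → γ k (i - + 2) ≡ + 0 → γ k (i - + 3) ≡ + 0 →
                 γ (suc k) i ≡ + 0
γ-suc-vanishes k i p q r rewrite p | q | r
  | *-zeroʳ (choose2 (i - + k - + 1)) | *-zeroʳ ((i - + 1) * (i - + k - + 2)) | *-zeroʳ (choose2 (i - + 1)) = refl

γ-negative : ∀ k n → γ k -[1+ n ] ≡ + 0
γ-negative zero    n = refl
γ-negative (suc k) n = γ-suc-vanishes k -[1+ n ] (γ-negative k _) (γ-negative k _) (γ-negative k _)

γ-vanishes-below : ∀ k j → j ≤ 2 ℕ.+ k → γ (suc k) (+ j) ≡ + 0
γ-vanishes-below zero 0 _ = refl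
γ-vanishes-below zero 1 _ = refl
γ-vanishes-below zero 2 _ = refl
γ-vanishes-below zero (suc (suc (suc _))) (s≤s (s≤s ()))
γ-vanishes-below (suc k) 0 _ =
  γ-suc-vanishes (suc k) (+ 0) (γ-negative (suc k) 0) (γ-negative (suc k) 1) (γ-negative (suc k) 2)
γ-vanishes-below (suc k) 1 _ =
  γ-suc-vanishes (suc k) (+ 1) (γ-vanishes-below k 0 z≤n) (γ-negative (suc k) 0) (γ-negative (suc k) 1)
γ-vanishes-below (suc k) 2 _ =
  γ-suc-vanishes (suc k) (+ 2) (γ-vanishes-below k 1 (s≤s z≤n)) (γ-vanishes-below k 0 z≤n) (γ-negative (suc k) 0)
γ-vanishes-below (suc k) (suc (suc (suc j))) (s≤s (s≤s (s≤s j≤k))) =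
  γ-suc-vanishes (suc k) (+ suc (suc (suc j)))
    (γ-vanishes-below k (suc (suc j)) (s≤s (s≤s j≤k)))
    (γ-vanishes-below k (suc j) (s≤s (ℕP.m≤n⇒m≤1+n j≤k)))
    (γ-vanishes-below k j (ℕP.m≤n⇒m≤1+n (ℕP.m≤n⇒m≤1+n j≤k)))

γ-vanishes-above : ∀ k m → 3 ℕ.* k ℕ.< m → γ k (+ m) ≡ + 0
γ-vanishes-above zero    (suc m) _  = refl
γ-vanishes-above (suc k) m 3k+3<m = go m (subst (ℕ._< m) (ℕP.*-suc 3 k) 3k+3<m)
  where
  go : ∀ m → 3 ℕ.+ 3 ℕ.* k ℕ.< m → γ (suc k) (+ m) ≡ + 0
  go (suc (suc (suc m))) (s≤s (s≤s (s≤s 3k<m))) =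
    γ-suc-vanishes k (+ suc (suc (suc m)))
      (γ-vanishes-above k (suc (suc m)) (ℕP.m<n⇒m<1+n (ℕP.m<n⇒m<1+n 3k<m)))
      (γ-vanishes-above k (suc m) (ℕP.m<n⇒m<1+n 3k<m))
      (γ-vanishes-above k m 3k<m)

γ₀ : γpoly 0 ≈S mono (+ 1) (+ 0)
γ₀ i = refl

γ₁ : γpoly 1 ≈S mono (+ 1) (+ 3)
γ₁ -[1+ n ] = γ-negative 1 n
γ₁ (+ 0) = refl
γ₁ (+ 1) = refl
γ₁ (+ 2) = refl
γ₁ (+ 3) = refl
γ₁ (+ suc (suc (suc (suc m)))) = γ-vanishes-above 1 (4 ℕ.+ m) (s≤s (s≤s (s≤s (s≤s z≤n))))

γ₂ : γpoly 2 ≈S mono (+ 1) (+ 4) ⊕ mono (+ 8) (+ 5) ⊕ mono (+ 10) (+ 6)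
γ₂ -[1+ n ] = γ-negative 2 n
γ₂ (+ 0) = refl
γ₂ (+ 1) = refl
γ₂ (+ 2) = refl
γ₂ (+ 3) = refl
γ₂ (+ 4) = refl
γ₂ (+ 5) = refl
γ₂ (+ 6) = refl
γ₂ (+ suc (suc (suc (suc (suc (suc (suc m))))))) =
  γ-vanishes-above 2 (7 ℕ.+ m) (s≤s (s≤s (s≤s (s≤s (s≤s (s≤s (s≤s z≤n)))))))

positive-combination : ∀ {a b c x y z} → Pos a → Pos b → Pos c → NonNeg x → NonNeg y → NonNeg z →
                       Pos x ⊎ Pos y ⊎ Pos z → Pos (a * x + b * y + c * z)
positive-combination a⁺ b⁺ c⁺ x⁰ y⁰ z⁰ (inj₁ x⁺) =
  +-Pos-NonNeg (+-Pos-NonNeg (*-Pos a⁺ x⁺) (*-NonNeg (Pos⇒NonNeg b⁺) y⁰)) (*-NonNeg (Pos⇒NonNeg c⁺) z⁰)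
positive-combination a⁺ b⁺ c⁺ x⁰ y⁰ z⁰ (inj₂ (inj₁ y⁺)) =
  +-Pos-NonNeg (+-NonNeg-Pos (*-NonNeg (Pos⇒NonNeg a⁺) x⁰) (*-Pos b⁺ y⁺)) (*-NonNeg (Pos⇒NonNeg c⁺) z⁰)
positive-combination a⁺ b⁺ c⁺ x⁰ y⁰ z⁰ (inj₂ (inj₂ z⁺)) =
  +-NonNeg-Pos (+-NonNeg (*-NonNeg (Pos⇒NonNeg a⁺) x⁰) (*-NonNeg (Pos⇒NonNeg b⁺) y⁰)) (*-Pos c⁺ z⁺)

≤-2+-cases : ∀ {d n} → d ≤ 2 ℕ.+ n → d ≤ n ⊎ d ≡ 1 ℕ.+ n ⊎ d ≡ 2 ℕ.+ n
≤-2+-cases d≤2+n with ℕP.m≤n⇒m<n∨m≡n d≤2+n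
... | inj₂ d≡2+n = inj₂ (inj₂ d≡2+n)
... | inj₁ (s≤s d≤1+n) with ℕP.m≤n⇒m<n∨m≡n d≤1+n
...   | inj₁ (s≤s d≤n) = inj₁ d≤n
...   | inj₂ d≡1+n     = inj₂ (inj₁ d≡1+n)

γ-suc-pos : ∀ K d → (∀ j → NonNeg (γ K (+ j))) →
  Pos (γ K (+ (2 ℕ.+ K ℕ.+ d))) ⊎ Pos (γ K (+ (1 ℕ.+ K ℕ.+ d))) ⊎ Pos (γ K (+ (K ℕ.+ d))) →
  Pos (γ (suc K) (+ (3 ℕ.+ K ℕ.+ d)))
γ-suc-pos K d nonneg =
  positive-combination c₁-pos b-pos (choose2-pos (K ℕ.+ d)) (nonneg _) (nonneg _) (nonneg _)
  where
  [3+K+D]-K-1≡2+D : ∀ K D → + 3 + (K + D) - K - + 1 ≡ + 2 + D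
  [3+K+D]-K-1≡2+D = solve-∀
  [3+K+D]-K-2≡1+D : ∀ K D → + 3 + (K + D) - K - + 2 ≡ + 1 + D
  [3+K+D]-K-2≡1+D = solve-∀
  c₁-pos : Pos (choose2 (+ (3 ℕ.+ K ℕ.+ d) - + K - + 1))
  c₁-pos = subst (Pos ∘ choose2) (sym ([3+K+D]-K-1≡2+D (+ K) (+ d))) (choose2-pos d)
  b-pos : Pos ((+ (3 ℕ.+ K ℕ.+ d) - + 1) * (+ (3 ℕ.+ K ℕ.+ d) - + K - + 2))
  b-pos = *-Pos (suc (K ℕ.+ d) , refl) (d , [3+K+D]-K-2≡1+D (+ K) (+ d))

γ-pos : ∀ k d → d ≤ 2 ℕ.* k → Pos (γ (suc k) (+ (3 ℕ.+ k ℕ.+ d)))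
γ-pos-between : ∀ k j → 3 ℕ.+ k ≤ j → j ≤ 3 ℕ.* suc k → Pos (γ (suc k) (+ j))
γ-nonneg : ∀ k j → NonNeg (γ (suc k) (+ j))

γ-pos zero zero _ = 0 , refl
γ-pos (suc k) d d≤2k+2 with ≤-2+-cases (subst (d ≤_) (ℕP.*-suc 2 k) d≤2k+2)
... | inj₁ d≤2k = γ-suc-pos (suc k) d (γ-nonneg k) (inj₁ (γ-pos k d d≤2k))
... | inj₂ (inj₁ refl) = γ-suc-pos (suc k) d (γ-nonneg k)
  (inj₂ (inj₁ (subst (λ j → Pos (γ (suc k) (+ suc (suc j)))) (sym (ℕP.+-suc k (2 ℕ.* k))) (γ-pos k (2 ℕ.* k) ℕP.≤-refl))))
... | inj₂ (inj₂ refl) = γ-suc-pos (suc k) d (γ-nonneg k)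
  (inj₂ (inj₂ (subst (λ j → Pos (γ (suc k) (+ suc j))) (sym (+-suc² k (2 ℕ.* k))) (γ-pos k (2 ℕ.* k) ℕP.≤-refl))))
  where
  +-suc² : ∀ m n → m ℕ.+ suc (suc n) ≡ suc (suc (m ℕ.+ n))
  +-suc² m n = trans (ℕP.+-suc m (suc n)) (cong suc (ℕP.+-suc m n))

γ-pos-between k j 3+k≤j j≤3k+3 =
  subst (Pos ∘ γ (suc k) ∘ +_) (ℕP.m+[n∸m]≡n 3+k≤j) (γ-pos k (j ℕ.∸ (3 ℕ.+ k)) j-3-k≤2k)
  where
  j-3-k≤2k : j ℕ.∸ (3 ℕ.+ k) ≤ 2 ℕ.* k
  j-3-k≤2k = subst (j ℕ.∸ (3 ℕ.+ k) ≤_)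
                   (trans (cong (ℕ._∸ (3 ℕ.+ k)) (ℕP.*-suc 3 k)) (ℕP.m+n∸m≡n k (2 ℕ.* k)))
                   (ℕP.∸-monoˡ-≤ (3 ℕ.+ k) j≤3k+3)

γ-nonneg k j with j ℕ.≤? 2 ℕ.+ k
... | yes j≤2+k = 0 , γ-vanishes-below k j j≤2+k
... | no j≰2+k with j ℕ.≤? 3 ℕ.* suc k
...   | yes j≤3k+3 = Pos⇒NonNeg (γ-pos-between k j (ℕP.≰⇒> j≰2+k) j≤3k+3)
...   | no j≰3k+3  = 0 , γ-vanishes-above (suc k) j (ℕP.≰⇒> j≰3k+3)

two-γ-suc : ∀ k i →
  + 2 * γ (suc k) i ≡ (i - + k - + 1) * (i - + k - + 1 - + 1) * γ k (i - + 1)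
                      + + 2 * ((i - + 1) * (i - + k - + 2)) * γ k (i - + 2)
                      + (i - + 1) * (i - + 1 - + 1) * γ k (i - + 3)
two-γ-suc k i =
  double (choose2 (i - + k - + 1)) ((i - + 1) * (i - + k - + 2)) (choose2 (i - + 1))
         (two-choose2 (i - + k - + 1)) (two-choose2 (i - + 1))
  where
  double : ∀ c₁ b c₃ {p₁ p₃ x y z} → + 2 * c₁ ≡ p₁ → + 2 * c₃ ≡ p₃ →
           + 2 * (c₁ * x + b * y + c₃ * z) ≡ p₁ * x + + 2 * b * y + p₃ * z
  double c₁ b c₃ {x = x} {y} {z} refl refl = solve (c₁ ∷ b ∷ c₃ ∷ x ∷ y ∷ z ∷ [])

D-pred : ∀ f i → D f (i - + 1) ≡ i * f i
D-pred f i = cong₂ _*_ i-1+1≡i (cong f i-1+1≡i)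
  where
  i-1+1≡i : i - + 1 + + 1 ≡ i
  i-1+1≡i = solve (i ∷ [])

mulP-pred : ∀ cs (g h : Ser) → (∀ j → g (j - + 1) ≡ h j) → ∀ i → mulP cs g (i - + 1) ≡ mulP cs h i
mulP-pred []       g h _       _ = refl
mulP-pred (c ∷ cs) g h g-pred≡h i = cong₂ _+_ (cong (c *_) (g-pred≡h i)) (mulP-pred cs g h g-pred≡h (i - + 1))

-- The i-th coefficients of x·D f and x²·D(D f) are i f(i) and (i-1) i f(i), so after shifting both
-- sides are polynomial combinations of f(i-1), f(i-2), f(i-3).
ode-step : ∀ (f : Ser) (K A₁ A₂ : ℤ) → A₁ ≡ K * (+ 1 + K) → A₂ ≡ + 2 * K → ∀ i →
  (i - K - + 1) * (i - K - + 1 - + 1) * f (i - + 1) + + 2 * ((i - + 1) * (i - K - + 2)) * f (i - + 2)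
  + (i - + 1) * (i - + 1 - + 1) * f (i - + 3)
  ≡ (mulP (+ 0 ∷ A₁ ∷ - A₂ ∷ + 2 ∷ []) f
     ⊖ mulP (+ 0 ∷ + 0 ∷ A₂ ∷ + 2 * (K - + 2) ∷ - + 4 ∷ []) (D f)
     ⊕ mulP (+ 0 ∷ + 0 ∷ + 0 ∷ + 1 ∷ + 2 ∷ + 1 ∷ []) (D (D f))) i
ode-step f K _ _ refl refl i = begin
  P₁ * f (i - + 1) + P₂ * f (i - + 2) + P₃ * f (i - + 3)
    ≡⟨ cong₂ (λ y z → P₁ * f (i - + 1) + P₂ * y + P₃ * z) (cong f (i-2≡i-1-1 i)) (cong f (i-3≡i-1-1-1 i)) ⟩
  P₁ * f (i - + 1) + P₂ * f (i - + 1 - + 1) + P₃ * f (i - + 1 - + 1 - + 1)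
    ≡⟨ identity i K (f i) (f (i - + 1)) (f (i - + 1 - + 1)) (f (i - + 1 - + 1 - + 1)) (D f i) (D (D f) i) ⟩
  M₁ - (+ 0 * D f i + mulP cs₂ (λ j → j * f j) i)
     + (+ 0 * D (D f) i + (+ 0 * (i * D f i) + mulP cs₃ (λ j → (j - + 1) * (j * f j)) i))
    ≡⟨ sym (cong₂ (λ u v → M₁ - (+ 0 * D f i + u) + (+ 0 * D (D f) i + v)) D-shifted DD-shifted) ⟩
  (mulP (+ 0 ∷ K * (+ 1 + K) ∷ - (+ 2 * K) ∷ + 2 ∷ []) f
     ⊖ mulP (+ 0 ∷ + 0 ∷ + 2 * K ∷ + 2 * (K - + 2) ∷ - + 4 ∷ []) (D f)
     ⊕ mulP (+ 0 ∷ + 0 ∷ + 0 ∷ + 1 ∷ + 2 ∷ + 1 ∷ []) (D (D f))) i ∎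
  where
  P₁ P₂ P₃ : ℤ
  P₁ = (i - K - + 1) * (i - K - + 1 - + 1)
  P₂ = + 2 * ((i - + 1) * (i - K - + 2))
  P₃ = (i - + 1) * (i - + 1 - + 1)
  M₁ : ℤ
  M₁ = mulP (+ 0 ∷ K * (+ 1 + K) ∷ - (+ 2 * K) ∷ + 2 ∷ []) f i
  cs₂ cs₃ : List ℤ
  cs₂ = + 0 ∷ + 2 * K ∷ + 2 * (K - + 2) ∷ - + 4 ∷ []
  cs₃ = + 0 ∷ + 1 ∷ + 2 ∷ + 1 ∷ []
  D-shifted : mulP cs₂ (D f) (i - + 1) ≡ mulP cs₂ (λ j → j * f j) i
  D-shifted = mulP-pred cs₂ (D f) (λ j → j * f j) (D-pred f) i
  DD-shifted : mulP (+ 0 ∷ cs₃) (D (D f)) (i - + 1) ≡ + 0 * (i * D f i) + mulP cs₃ (λ j → (j - + 1) * (j * f j)) i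
  DD-shifted = trans (mulP-pred (+ 0 ∷ cs₃) (D (D f)) (λ j → j * D f j) (D-pred (D f)) i)
                     (cong (λ v → + 0 * (i * D f i) + v)
                           (mulP-pred cs₃ (λ j → j * D f j) (λ j → (j - + 1) * (j * f j))
                                      (λ j → cong ((j - + 1) *_) (D-pred f j)) i))
  i-2≡i-1-1 : ∀ i → i - + 2 ≡ i - + 1 - + 1
  i-2≡i-1-1 = solve-∀
  i-3≡i-1-1-1 : ∀ i → i - + 3 ≡ i - + 1 - + 1 - + 1
  i-3≡i-1-1-1 = solve-∀
  identity : ∀ i K y₀ y₁ y₂ y₃ d₀ e₀ →
    (i - K - + 1) * (i - K - + 1 - + 1) * y₁ + + 2 * ((i - + 1) * (i - K - + 2)) * y₂ + (i - + 1) * (i - + 1 - + 1) * y₃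
    ≡ (+ 0 * y₀ + (K * (+ 1 + K) * y₁ + (- (+ 2 * K) * y₂ + (+ 2 * y₃ + + 0))))
      - (+ 0 * d₀ + (+ 0 * (i * y₀) + (+ 2 * K * ((i - + 1) * y₁) + (+ 2 * (K - + 2) * ((i - + 1 - + 1) * y₂)
        + (- + 4 * ((i - + 1 - + 1 - + 1) * y₃) + + 0)))))
      + (+ 0 * e₀ + (+ 0 * (i * d₀) + (+ 0 * ((i - + 1) * (i * y₀)) + (+ 1 * ((i - + 1 - + 1) * ((i - + 1) * y₁))
        + (+ 2 * ((i - + 1 - + 1 - + 1) * ((i - + 1 - + 1) * y₂))
        + (+ 1 * ((i - + 1 - + 1 - + 1 - + 1) * ((i - + 1 - + 1 - + 1) * y₃)) + + 0))))))
  identity = solve-∀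

γpoly-ode : ∀ k →
  scale (+ 2) (γpoly (suc k))
    ≈S mulP (+ 0 ∷ + (k ℕ.* suc k) ∷ - + (2 ℕ.* k) ∷ + 2 ∷ []) (γpoly k)
       ⊖ mulP (+ 0 ∷ + 0 ∷ + (2 ℕ.* k) ∷ (+ 2 * (+ k - + 2)) ∷ - + 4 ∷ []) (D (γpoly k))
       ⊕ mulP (+ 0 ∷ + 0 ∷ + 0 ∷ + 1 ∷ + 2 ∷ + 1 ∷ []) (D (D (γpoly k)))
γpoly-ode k i = trans (two-γ-suc k i) (ode-step (γpoly k) (+ k) _ _ (pos-* k (suc k)) (pos-* 2 k) i)

binom : ℕ → ℤ → ℤ
binom N (+ i)    = + (N C i)
binom N -[1+ _ ] = + 0

binom-pascal : ∀ N i → binom (suc N) i ≡ binom N (i - + 1) + binom N i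
binom-pascal N -[1+ _ ] = refl
binom-pascal N (+ zero)  = refl
binom-pascal N (+ suc j) = trans (cong +_ (sym (nCk+nC[k+1]≡[n+1]C[k+1] N j))) (pos-+ (N C j) (N C suc j))

binom-absorb : ∀ N i → i * binom N i ≡ (+ N - i + + 1) * binom N (i - + 1)
binom-absorb zero -[1+ n ]         = trans (*-zeroʳ -[1+ n ]) (sym (*-zeroʳ (+ 0 - -[1+ n ] + + 1)))
binom-absorb zero (+ 0)            = refl
binom-absorb zero (+ 1)            = refl
binom-absorb zero (+ suc (suc n))  = trans (*-zeroʳ (+ suc (suc n))) (sym (*-zeroʳ (+ 0 - + suc (suc n) + + 1)))
binom-absorb (suc N) i = begin
  i * binom (suc N) i                                          ≡⟨ cong (i *_) (binom-pascal N i) ⟩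
  i * (binom N (i - + 1) + binom N i)                          ≡⟨ step (+ N) i _ _ _ (binom-absorb N (i - + 1)) (binom-absorb N i) ⟩
  (+ 1 + + N - i + + 1) * (binom N (i - + 1 - + 1) + binom N (i - + 1)) ≡⟨ cong ((+ suc N - i + + 1) *_) (sym (binom-pascal N (i - + 1))) ⟩
  (+ suc N - i + + 1) * binom (suc N) (i - + 1)                ∎
  where
  step : ∀ n i b₂ b₁ b₀ → (i - + 1) * b₁ ≡ (n - (i - + 1) + + 1) * b₂ → i * b₀ ≡ (n - i + + 1) * b₁ →
         i * (b₁ + b₀) ≡ (+ 1 + n - i + + 1) * (b₂ + b₁)
  step n i b₂ b₁ b₀ absorb₁ absorb₀ = begin
    i * (b₁ + b₀)                                        ≡⟨ solve (n ∷ i ∷ b₂ ∷ b₁ ∷ b₀ ∷ []) ⟩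
    (i - + 1) * b₁ + b₁ + i * b₀                         ≡⟨ cong₂ (λ x y → x + b₁ + y) absorb₁ absorb₀ ⟩
    (n - (i - + 1) + + 1) * b₂ + b₁ + (n - i + + 1) * b₁ ≡⟨ solve (n ∷ i ∷ b₂ ∷ b₁ ∷ b₀ ∷ []) ⟩
    (+ 1 + n - i + + 1) * (b₂ + b₁)                      ∎

∑ : ℕ → (ℕ → ℤ) → ℤ
∑ n f = foldr _+_ (+ 0) (applyUpTo f n)

∑-cong : ∀ n {f g : ℕ → ℤ} → (∀ j → f j ≡ g j) → ∑ n f ≡ ∑ n g
∑-cong zero    _   = refl
∑-cong (suc n) f≡g = cong₂ _+_ (f≡g 0) (∑-cong n (f≡g ∘ suc))

∑-+ : ∀ n (f g : ℕ → ℤ) → ∑ n (λ j → f j + g j) ≡ ∑ n f + ∑ n g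
∑-+ zero    f g = refl
∑-+ (suc n) f g = trans (cong (_+_ (f 0 + g 0)) (∑-+ n (f ∘ suc) (g ∘ suc))) (interchange +-commutativeSemigroup (f 0) (g 0) _ _)

∑-*ˡ : ∀ n c (f : ℕ → ℤ) → ∑ n (λ j → c * f j) ≡ c * ∑ n f
∑-*ˡ zero    c f = sym (*-zeroʳ c)
∑-*ˡ (suc n) c f = trans (cong (_+_ (c * f 0)) (∑-*ˡ n c (f ∘ suc))) (sym (*-distribˡ-+ c (f 0) _))

∑-zero : ∀ n {f : ℕ → ℤ} → (∀ j → j ℕ.< n → f j ≡ + 0) → ∑ n f ≡ + 0
∑-zero zero    _   = refl
∑-zero (suc n) f≡0 = cong₂ _+_ (f≡0 0 (s≤s z≤n)) (∑-zero n (λ j j<n → f≡0 (suc j) (s≤s j<n)))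

∑-++ : ∀ m n (f : ℕ → ℤ) → ∑ (m ℕ.+ n) f ≡ ∑ m f + ∑ n (λ j → f (m ℕ.+ j))
∑-++ zero    n f = sym (+-identityˡ _)
∑-++ (suc m) n f = trans (cong (_+_ (f 0)) (∑-++ m n (f ∘ suc))) (sym (+-assoc (f 0) _ _))

∑-vanishing-tail : ∀ m n (f : ℕ → ℤ) → (∀ j → f (n ℕ.+ j) ≡ + 0) → ∑ (m ℕ.+ n) f ≡ ∑ n f
∑-vanishing-tail m n f tail≡0 = begin
  ∑ (m ℕ.+ n) f                        ≡⟨ cong (λ l → ∑ l f) (ℕP.+-comm m n) ⟩
  ∑ (n ℕ.+ m) f                        ≡⟨ ∑-++ n m f ⟩
  ∑ n f + ∑ m (λ j → f (n ℕ.+ j))      ≡⟨ cong (_+_ (∑ n f)) (∑-zero m (λ j _ → tail≡0 j)) ⟩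
  ∑ n f + + 0                          ≡⟨ +-identityʳ _ ⟩
  ∑ n f                                ∎

∑-shift : ∀ m n (h : ℤ → ℤ) → (∀ p → h -[1+ p ] ≡ + 0) →
          ∑ (suc m ℕ.+ n) (λ j → h (+ j - + suc m)) ≡ ∑ n (h ∘ +_)
∑-shift zero    n h h⁻≡0 = trans (cong (_+ ∑ n (h ∘ +_)) (h⁻≡0 0)) (+-identityˡ _)
∑-shift (suc m) n h h⁻≡0 = begin
  h -[1+ suc m ] + ∑ (suc m ℕ.+ n) (λ j → h (+ suc j - + suc (suc m)))
    ≡⟨ cong₂ _+_ (h⁻≡0 (suc m)) (∑-cong (suc m ℕ.+ n) (λ j → cong h ([1+m]⊖[1+n]≡m⊖n j (suc m)))) ⟩
  + 0 + ∑ (suc m ℕ.+ n) (λ j → h (+ j - + suc m))  ≡⟨ +-identityˡ _ ⟩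
  ∑ (suc m ℕ.+ n) (λ j → h (+ j - + suc m))        ≡⟨ ∑-shift m n h h⁻≡0 ⟩
  ∑ n (h ∘ +_)                                     ∎

term : ℕ → ℕ → ℤ → ℤ
term k N i = γ k i * binom N i

-- The range 0 … 3k covers the support of γ k and does not depend on N, so that Pascal's rule
-- relates G k (suc N) to G k N without boundary terms.
G : ℕ → ℕ → ℤ
G k N = ∑ (suc (3 ℕ.* k)) (term k N ∘ +_)

term-negative : ∀ k N p → term k N -[1+ p ] ≡ + 0
term-negative k N p = *-zeroʳ (γ k -[1+ p ])

term-above : ∀ k N j → term k N (+ (suc (3 ℕ.* k) ℕ.+ j)) ≡ + 0
term-above k N j = cong (_* binom N (+ (suc (3 ℕ.* k) ℕ.+ j))) (γ-vanishes-above k _ (s≤s (ℕP.m≤m+n (3 ℕ.* k) j)))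

-- With u = i - k and v = N - i these are u(u-1), 2uv and v(v-1), which add up to (u+v)(u+v-1).
uu : ℕ → ℤ → ℤ
uu k i = (i - + k) * (i - + k - + 1)

uv : ℕ → ℕ → ℤ → ℤ
uv k N i = + 2 * (i - + k) * (+ N - i)

vv : ℕ → ℤ → ℤ
vv N i = (+ N - i) * (+ N - i - + 1)

uu+uv+vv : ∀ k N i → uu k i + uv k N i + vv N i ≡ (+ N - + k) * (+ N - + k - + 1)
uu+uv+vv k N i = identity (+ k) (+ N) i
  where
  identity : ∀ K n i → (i - K) * (i - K - + 1) + + 2 * (i - K) * (n - i) + (n - i) * (n - i - + 1)
                       ≡ (n - K) * (n - K - + 1)
  identity = solve-∀

two-γ-suc-binom : ∀ k N i →
  + 2 * (γ (suc k) i * binom N (i - + 1))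
  ≡ uu k (i - + 1) * term k N (i - + 1) + uv k N (i - + 2) * term k N (i - + 2) + vv N (i - + 3) * term k N (i - + 3)
two-γ-suc-binom k N i =
  trans (sym (*-assoc (+ 2) (γ (suc k) i) (binom N (i - + 1))))
        (trans (cong (_* binom N (i - + 1)) (two-γ-suc k i)) (absorbed i (+ k) (+ N) _ _ _ _ _ _ absorb₁ absorb₂))
  where
  absorb₁ : (i - + 1) * binom N (i - + 1) ≡ (+ N - (i - + 1) + + 1) * binom N (i - + 2)
  absorb₁ = trans (binom-absorb N (i - + 1)) (cong (λ j → (+ N - (i - + 1) + + 1) * binom N j) (solve (i ∷ [])))
  absorb₂ : (i - + 2) * binom N (i - + 2) ≡ (+ N - (i - + 2) + + 1) * binom N (i - + 3)
  absorb₂ = trans (binom-absorb N (i - + 2)) (cong (λ j → (+ N - (i - + 2) + + 1) * binom N j) (solve (i ∷ [])))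
  absorbed : ∀ i K n g₁ g₂ g₃ β₁ β₂ β₃ →
    (i - + 1) * β₁ ≡ (n - (i - + 1) + + 1) * β₂ → (i - + 2) * β₂ ≡ (n - (i - + 2) + + 1) * β₃ →
    ((i - K - + 1) * (i - K - + 1 - + 1) * g₁ + + 2 * ((i - + 1) * (i - K - + 2)) * g₂ + (i - + 1) * (i - + 1 - + 1) * g₃) * β₁
    ≡ (i - + 1 - K) * (i - + 1 - K - + 1) * (g₁ * β₁) + + 2 * (i - + 2 - K) * (n - (i - + 2)) * (g₂ * β₂)
      + (n - (i - + 3)) * (n - (i - + 3) - + 1) * (g₃ * β₃)
  absorbed i K n g₁ g₂ g₃ β₁ β₂ β₃ absorb₁ absorb₂ = begin
    ((i - K - + 1) * (i - K - + 1 - + 1) * g₁ + + 2 * ((i - + 1) * (i - K - + 2)) * g₂ + (i - + 1) * (i - + 1 - + 1) * g₃) * β₁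
      ≡⟨ solve vars ⟩
    (i - K - + 1) * (i - K - + 2) * (g₁ * β₁) + + 2 * (i - K - + 2) * g₂ * ((i - + 1) * β₁) + (i - + 2) * g₃ * ((i - + 1) * β₁)
      ≡⟨ cong₂ (λ x y → (i - K - + 1) * (i - K - + 2) * (g₁ * β₁) + + 2 * (i - K - + 2) * g₂ * x + (i - + 2) * g₃ * y) absorb₁ absorb₁ ⟩
    (i - K - + 1) * (i - K - + 2) * (g₁ * β₁) + + 2 * (i - K - + 2) * g₂ * ((n - (i - + 1) + + 1) * β₂)
      + (i - + 2) * g₃ * ((n - (i - + 1) + + 1) * β₂)
      ≡⟨ solve vars ⟩
    (i - K - + 1) * (i - K - + 2) * (g₁ * β₁) + + 2 * (i - K - + 2) * g₂ * ((n - (i - + 1) + + 1) * β₂)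
      + (n - (i - + 1) + + 1) * g₃ * ((i - + 2) * β₂)
      ≡⟨ cong (λ x → (i - K - + 1) * (i - K - + 2) * (g₁ * β₁) + + 2 * (i - K - + 2) * g₂ * ((n - (i - + 1) + + 1) * β₂)
                     + (n - (i - + 1) + + 1) * g₃ * x) absorb₂ ⟩
    (i - K - + 1) * (i - K - + 2) * (g₁ * β₁) + + 2 * (i - K - + 2) * g₂ * ((n - (i - + 1) + + 1) * β₂)
      + (n - (i - + 1) + + 1) * g₃ * ((n - (i - + 2) + + 1) * β₃)
      ≡⟨ solve vars ⟩
    (i - + 1 - K) * (i - + 1 - K - + 1) * (g₁ * β₁) + + 2 * (i - + 2 - K) * (n - (i - + 2)) * (g₂ * β₂)
      + (n - (i - + 3)) * (n - (i - + 3) - + 1) * (g₃ * β₃) ∎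
    where
    vars : List ℤ
    vars = i ∷ K ∷ n ∷ g₁ ∷ g₂ ∷ g₃ ∷ β₁ ∷ β₂ ∷ β₃ ∷ []

two-∑-shifted : ∀ k N →
  + 2 * ∑ (suc (3 ℕ.* suc k)) (λ j → γ (suc k) (+ j) * binom N (+ j - + 1))
  ≡ (+ N - + k) * (+ N - + k - + 1) * G k N
two-∑-shifted k N = begin
  + 2 * ∑ (suc (3 ℕ.* suc k)) f                       ≡⟨ sym (∑-*ˡ (suc (3 ℕ.* suc k)) (+ 2) f) ⟩
  ∑ (suc (3 ℕ.* suc k)) (λ j → + 2 * f j)             ≡⟨ cong (λ l → ∑ (suc l) (λ j → + 2 * f j)) (ℕP.*-suc 3 k) ⟩
  ∑ (3 ℕ.+ R) (λ j → + 2 * f j)                       ≡⟨ ∑-cong (3 ℕ.+ R) (λ j → two-γ-suc-binom k N (+ j)) ⟩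
  ∑ (3 ℕ.+ R) (λ j → U (+ j - + 1) + M (+ j - + 2) + V (+ j - + 3))
    ≡⟨ ∑-+₃ (3 ℕ.+ R) (λ j → U (+ j - + 1)) (λ j → M (+ j - + 2)) (λ j → V (+ j - + 3)) ⟩
  ∑ (3 ℕ.+ R) (λ j → U (+ j - + 1)) + ∑ (3 ℕ.+ R) (λ j → M (+ j - + 2)) + ∑ (3 ℕ.+ R) (λ j → V (+ j - + 3))
    ≡⟨ cong₂ _+_ (cong₂ _+_ (shift-into-range 0 2 (uu k)) (shift-into-range 1 1 (uv k N))) (shift-into-range 2 0 (vv N)) ⟩
  ∑ R (U ∘ +_) + ∑ R (M ∘ +_) + ∑ R (V ∘ +_)          ≡⟨ sym (∑-+₃ R (U ∘ +_) (M ∘ +_) (V ∘ +_)) ⟩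
  ∑ R (λ j → U (+ j) + M (+ j) + V (+ j))             ≡⟨ ∑-cong R (λ j → weights-add-up (+ j)) ⟩
  ∑ R (λ j → c * term k N (+ j))                      ≡⟨ ∑-*ˡ R c (term k N ∘ +_) ⟩
  c * G k N                                           ∎
  where
  R : ℕ
  R = suc (3 ℕ.* k)
  c : ℤ
  c = (+ N - + k) * (+ N - + k - + 1)
  f : ℕ → ℤ
  f j = γ (suc k) (+ j) * binom N (+ j - + 1)
  U M V : ℤ → ℤ
  U i = uu k i * term k N i
  M i = uv k N i * term k N i
  V i = vv N i * term k N i
  ∑-+₃ : ∀ n (f g h : ℕ → ℤ) → ∑ n (λ j → f j + g j + h j) ≡ ∑ n f + ∑ n g + ∑ n h
  ∑-+₃ n f g h = trans (∑-+ n (λ j → f j + g j) h) (cong (_+ ∑ n h) (∑-+ n f g))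
  shift-into-range : ∀ m t (a : ℤ → ℤ) →
    ∑ (suc m ℕ.+ (t ℕ.+ R)) (λ j → a (+ j - + suc m) * term k N (+ j - + suc m)) ≡ ∑ R (λ j → a (+ j) * term k N (+ j))
  shift-into-range m t a =
    trans (∑-shift m (t ℕ.+ R) (λ i → a i * term k N i) (λ p → weighted (term-negative k N p)))
          (∑-vanishing-tail t R (λ j → a (+ j) * term k N (+ j)) (λ j → weighted (term-above k N j)))
    where
    weighted : ∀ {i} → term k N i ≡ + 0 → a i * term k N i ≡ + 0
    weighted {i} t≡0 = trans (cong (a i *_) t≡0) (*-zeroʳ (a i))
  weights-add-up : ∀ i → U i + M i + V i ≡ c * term k N i
  weights-add-up i = begin
    uu k i * t + uv k N i * t + vv N i * t       ≡⟨ distribʳ₃ (uu k i) (uv k N i) (vv N i) t ⟩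
    (uu k i + uv k N i + vv N i) * t              ≡⟨ cong (_* t) (uu+uv+vv k N i) ⟩
    c * t                                         ∎
    where
    t : ℤ
    t = term k N i
    distribʳ₃ : ∀ a b c t → a * t + b * t + c * t ≡ (a + b + c) * t
    distribʳ₃ = solve-∀

two-G-recurrence : ∀ k N → + 2 * G (suc k) (suc N) ≡ + 2 * G (suc k) N + (+ N - + k) * (+ N - + k - + 1) * G k N
two-G-recurrence k N = begin
  + 2 * G (suc k) (suc N)              ≡⟨ cong (+ 2 *_) pascal ⟩
  + 2 * (∑ R f + G (suc k) N)          ≡⟨ *-distribˡ-+ (+ 2) (∑ R f) (G (suc k) N) ⟩
  + 2 * ∑ R f + + 2 * G (suc k) N      ≡⟨ cong (_+ + 2 * G (suc k) N) (two-∑-shifted k N) ⟩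
  (+ N - + k) * (+ N - + k - + 1) * G k N + + 2 * G (suc k) N ≡⟨ +-comm ((+ N - + k) * (+ N - + k - + 1) * G k N) _ ⟩
  + 2 * G (suc k) N + (+ N - + k) * (+ N - + k - + 1) * G k N ∎
  where
  R : ℕ
  R = suc (3 ℕ.* suc k)
  f : ℕ → ℤ
  f j = γ (suc k) (+ j) * binom N (+ j - + 1)
  pascal : G (suc k) (suc N) ≡ ∑ R f + G (suc k) N
  pascal = trans (∑-cong R (λ j → trans (cong (γ (suc k) (+ j) *_) (binom-pascal N (+ j)))
                                        (*-distribˡ-+ (γ (suc k) (+ j)) (binom N (+ j - + 1)) (binom N (+ j)))))
                 (∑-+ R f (term (suc k) N ∘ +_))

G-vanishes : ∀ k N → N ≤ 2 ℕ.+ k → G (suc k) N ≡ + 0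
G-vanishes k N N≤2+k = ∑-zero _ term≡0
  where
  term≡0 : ∀ j → j ℕ.< suc (3 ℕ.* suc k) → term (suc k) N (+ j) ≡ + 0
  term≡0 j _ with j ℕ.≤? 2 ℕ.+ k
  ... | yes j≤2+k = cong (_* binom N (+ j)) (γ-vanishes-below k j j≤2+k)
  ... | no  j≰2+k = trans (cong (γ (suc k) (+ j) *_) (cong +_ (k>n⇒nCk≡0 (ℕP.≤-<-trans N≤2+k (ℕP.≰⇒> j≰2+k)))))
                          (*-zeroʳ (γ (suc k) (+ j)))

scaled-G-recurrence : ∀ k N →
  + (2 ^ suc k) * G (suc k) (suc N)
  ≡ + (2 ^ suc k) * G (suc k) N + (+ N - + k) * (+ N - + k - + 1) * (+ (2 ^ k) * G k N)
scaled-G-recurrence k N =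
  subst (λ Q → Q * G (suc k) (suc N) ≡ Q * G (suc k) N + c * (+ (2 ^ k) * G k N)) (sym (pos-* 2 (2 ^ k)))
        (multiply (+ (2 ^ k)) c (G (suc k) (suc N)) (G (suc k) N) (G k N) (two-G-recurrence k N))
  where
  c : ℤ
  c = (+ N - + k) * (+ N - + k - + 1)
  multiply : ∀ P c X Y Z → + 2 * X ≡ + 2 * Y + c * Z → + 2 * P * X ≡ + 2 * P * Y + c * (P * Z)
  multiply P c X Y Z 2X≡ = begin
    + 2 * P * X               ≡⟨ solve (P ∷ X ∷ Y ∷ Z ∷ c ∷ []) ⟩
    P * (+ 2 * X)             ≡⟨ cong (P *_) 2X≡ ⟩
    P * (+ 2 * Y + c * Z)     ≡⟨ solve (P ∷ X ∷ Y ∷ Z ∷ c ∷ []) ⟩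
    + 2 * P * Y + c * (P * Z) ∎

LS-above : ∀ n m → n ℕ.< m → LS n m ≡ 0
LS-above zero    (suc m) _         = refl
LS-above (suc n) (suc m) (s≤s n<m)
  rewrite LS-above n m n<m | LS-above n (suc m) (ℕP.m≤n⇒m≤1+n n<m) = ℕP.*-zeroʳ (suc m ℕ.* suc (suc m))

LS-diag : ∀ n → LS n n ≡ 1
LS-diag zero    = refl
LS-diag (suc n) rewrite LS-diag n | LS-above n (suc n) (ℕP.n<1+n n) | ℕP.*-zeroʳ (suc n ℕ.* suc (suc n)) = refl

LS-as-G : ∀ k n → + LS (n ℕ.+ k) n ≡ + (2 ^ k) * G k (n ℕ.+ k ℕ.+ 1)
LS-as-G zero n rewrite ℕP.+-identityʳ n | LS-diag n = refl
LS-as-G (suc k) zero = sym (trans (cong (+ (2 ^ suc k) *_) (G-vanishes k (suc k ℕ.+ 1) k+2≤2+k))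
                                  (*-zeroʳ (+ (2 ^ suc k))))
  where
  k+2≤2+k : suc k ℕ.+ 1 ≤ 2 ℕ.+ k
  k+2≤2+k = ℕP.≤-reflexive (ℕP.+-comm (suc k) 1)
LS-as-G (suc k) (suc n) = begin
  + LS (suc n ℕ.+ suc k) (suc n)
    ≡⟨ pos-+ (LS (n ℕ.+ suc k) n) (suc n ℕ.* suc (suc n) ℕ.* LS (n ℕ.+ suc k) (suc n)) ⟩
  + LS (n ℕ.+ suc k) n + + (suc n ℕ.* suc (suc n) ℕ.* LS (n ℕ.+ suc k) (suc n))
    ≡⟨ cong₂ _+_ (LS-as-G (suc k) n)
                 (trans (pos-* (suc n ℕ.* suc (suc n)) (LS (n ℕ.+ suc k) (suc n))) (cong₂ _*_ coefficient LS-as-G-k)) ⟩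
  + (2 ^ suc k) * G (suc k) N + (+ N - + k) * (+ N - + k - + 1) * (+ (2 ^ k) * G k N)
    ≡⟨ sym (scaled-G-recurrence k N) ⟩
  + (2 ^ suc k) * G (suc k) (suc N) ∎
  where
  N : ℕ
  N = n ℕ.+ suc k ℕ.+ 1
  LS-as-G-k : + LS (n ℕ.+ suc k) (suc n) ≡ + (2 ^ k) * G k N
  LS-as-G-k = subst (λ m → + LS m (suc n) ≡ + (2 ^ k) * G k (m ℕ.+ 1)) (sym (ℕP.+-suc n k)) (LS-as-G k (suc n))
  coefficient : + (suc n ℕ.* suc (suc n)) ≡ (+ N - + k) * (+ N - + k - + 1)
  coefficient = begin
    + (suc n ℕ.* suc (suc n))                  ≡⟨ pos-* (suc n) (suc (suc n)) ⟩
    (+ 1 + + n) * (+ 2 + + n)                  ≡⟨ identity (+ n) (+ k) ⟩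
    (+ n + (+ 1 + + k) + + 1 - + k) * (+ n + (+ 1 + + k) + + 1 - + k - + 1)
      ≡⟨ cong (λ x → (x - + k) * (x - + k - + 1)) (sym (trans (pos-+ (n ℕ.+ suc k) 1) (cong (_+ + 1) (pos-+ n (suc k))))) ⟩
    (+ N - + k) * (+ N - + k - + 1)            ∎
    where
    identity : ∀ n k → (+ 1 + n) * (+ 2 + n) ≡ (n + (+ 1 + k) + + 1 - k) * (n + (+ 1 + k) + + 1 - k - + 1)
    identity = solve-∀

G-as-sumFT : ∀ k N → G (suc k) N ≡ sumFT (suc k ℕ.+ 2) (3 ℕ.* suc k) (λ i → γ (suc k) (+ i) * + (N C i))
G-as-sumFT k N = begin
  ∑ (suc (3 ℕ.* suc k)) f                    ≡⟨ cong (λ l → ∑ l f) (sym (ℕP.m+[n∸m]≡n k+3≤3k+4)) ⟩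
  ∑ (suc k ℕ.+ 2 ℕ.+ L) f                    ≡⟨ ∑-++ (suc k ℕ.+ 2) L f ⟩
  ∑ (suc k ℕ.+ 2) f + ∑ L (λ j → f (suc k ℕ.+ 2 ℕ.+ j))
    ≡⟨ cong (_+ ∑ L (λ j → f (suc k ℕ.+ 2 ℕ.+ j))) (∑-zero (suc k ℕ.+ 2) below) ⟩
  + 0 + ∑ L (λ j → f (suc k ℕ.+ 2 ℕ.+ j))    ≡⟨ +-identityˡ _ ⟩
  ∑ L (λ j → f (suc k ℕ.+ 2 ℕ.+ j))          ≡⟨ cong (foldr _+_ (+ 0)) (sym (map-upTo (λ j → f (suc k ℕ.+ 2 ℕ.+ j)) L)) ⟩
  sumFT (suc k ℕ.+ 2) (3 ℕ.* suc k) f        ∎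
  where
  f : ℕ → ℤ
  f = term (suc k) N ∘ +_
  L : ℕ
  L = suc (3 ℕ.* suc k) ℕ.∸ (suc k ℕ.+ 2)
  k+3≤3k+4 : suc k ℕ.+ 2 ≤ suc (3 ℕ.* suc k)
  k+3≤3k+4 = s≤s (subst₂ _≤_ (ℕP.+-comm 2 k) (sym (ℕP.*-suc 3 k))
                         (s≤s (s≤s (ℕP.m≤n⇒m≤1+n (ℕP.m≤m+n k (2 ℕ.* k))))))
  below : ∀ j → j ℕ.< suc k ℕ.+ 2 → f j ≡ + 0
  below j (s≤s j≤k+2) = cong (_* binom N (+ j)) (γ-vanishes-below k j (subst (j ≤_) (ℕP.+-comm k 2) j≤k+2))

Pos⇒0< : ∀ {i} → Pos i → + 0 < i
Pos⇒0< (_ , refl) = +<+ (s≤s z≤n)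

theorem1 :
  (∀ (k n : ℕ) → 1 ≤ k → 1 ≤ n →
      + LS (n Data.Nat.+ k) n
        ≡ + (2 ^ k) * sumFT (k Data.Nat.+ 2) (3 Data.Nat.* k)
                        (λ i → γ k (+ i) * + ((n Data.Nat.+ k Data.Nat.+ 1) C i)))
  × (∀ (k i : ℕ) → 1 ≤ k → k Data.Nat.+ 2 ≤ i → i ≤ 3 Data.Nat.* k → + 0 < γ k (+ i))
  × (∀ (k : ℕ) →
      scale (+ 2) (γpoly (Data.Nat.suc k))
        ≈S mulP (+ 0 ∷ + (k Data.Nat.* Data.Nat.suc k) ∷ - + (2 Data.Nat.* k) ∷ + 2 ∷ []) (γpoly k)
           ⊖ mulP (+ 0 ∷ + 0 ∷ + (2 Data.Nat.* k) ∷ (+ 2 * (+ k Data.Integer.- + 2)) ∷ - + 4 ∷ []) (D (γpoly k))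
           ⊕ mulP (+ 0 ∷ + 0 ∷ + 0 ∷ + 1 ∷ + 2 ∷ + 1 ∷ []) (D (D (γpoly k))))
  × (γpoly 0 ≈S mono (+ 1) (+ 0))
  × (γpoly 1 ≈S mono (+ 1) (+ 3))
  × (γpoly 2 ≈S mono (+ 1) (+ 4) ⊕ mono (+ 8) (+ 5) ⊕ mono (+ 10) (+ 6))
theorem1 = LS-formula , γ-positive , γpoly-ode , γ₀ , γ₁ , γ₂
  where
  LS-formula : ∀ k n → 1 ≤ k → 1 ≤ n →
    + LS (n ℕ.+ k) n ≡ + (2 ^ k) * sumFT (k ℕ.+ 2) (3 ℕ.* k) (λ i → γ k (+ i) * + ((n ℕ.+ k ℕ.+ 1) C i))
  LS-formula (suc k) n _ _ =
    trans (LS-as-G (suc k) n) (cong (+ (2 ^ suc k) *_) (G-as-sumFT k (n ℕ.+ suc k ℕ.+ 1)))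
  γ-positive : ∀ k i → 1 ≤ k → k ℕ.+ 2 ≤ i → i ≤ 3 ℕ.* k → + 0 < γ k (+ i)
  γ-positive (suc k) i _ k+3≤i i≤3k+3 =
    Pos⇒0< (γ-pos-between k i (subst (_≤ i) (ℕP.+-comm (suc k) 2) k+3≤i) i≤3k+3)
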